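{- A nominal poset $\mathcal L$ is finitely fresh-complete if and only if it has a greatest element $\top$, a greatest lower bound $x\wedge y$ of $\{x,y\}$ for all $x,y$, and an $a\#$limit $\bigwedge^{\#a}x$ of $\{x\}$ for every atom $a$ and every $x$. Similarly, $\mathcal L$ is finitely fresh-cocomplete if and only if it has a least element $\bot$, least upper bounds $x\vee y$, and $a\#$colimits $\bigvee^{\#a}x$ of singletons.
   Context: Atoms $\mathbb A$ countably infinite; nominal sets, support $\mathrm{supp}$, and freshness $a\#x$ ($a\notin\mathrm{supp}(x)$) as standard. A nominal poset is a nominal set with an equivariant partial order $\le$. For finite $X\subseteq\mathcal L$ and finite $A\subseteq\mathbb A$, an $A\#$limit $\bigwedge^{\#A}X$ is a greatest element of $\{x'\mid A\cap\mathrm{supp}(x')=\emptyset,\ x'\le x\text{ for all }x\in X\}$, and an $A\#$colimit $\bigvee^{\#A}X$ is a least element of $\{x'\mid A\cap\mathrm{supp}(x')=\emptyset,\ x\le x'\text{ for all }x\in X\}$. $\mathcal L$ is finitely fresh-complete (resp. cocomplete) if all $A\#$limits (resp. colimits) exist for all finite $X$ and finite $A$. The $a\#$limit of $\{x\}$ means the $\{a\}\#$limit of $\{x\}$. -}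

module Defs where

open import Level using (Level; _⊔_; suc)
open import Data.Nat using (ℕ; _≟_)
open import Data.Product using (Σ; _×_; _,_)
open import Data.List using (List; []; _∷_)
open import Data.List.Membership.Propositional using (_∈_; _∉_)
open import Relation.Nullary using (¬_; yes; no)
open import Relation.Binary.PropositionalEquality using (_≡_)
open import Relation.Binary.Structures using (IsPartialOrder)
open import Function.Bundles using (_⇔_)

Atom : Set
Atom = ℕ

sw : Atom → Atom → Atom → Atom
sw a b c with c ≟ a
... | yes _ = b
... | no _ with c ≟ b
...   | yes _ = a
...   | no _ = c

Supports : {c : Level} {X : Set c} → (Atom → Atom → X → X) → List Atom → X → Set c
Supports swap A x = ∀ a b → a ∉ A → b ∉ A → swap a b x ≡ x

-- Nominal sets, presented via swapping actions (Pitts, "Nominal Sets", Ch. 6),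
-- equipped with the (least, finite) support of each element.
record NominalSet (c : Level) : Set (suc c) where
  field
    Carrier : Set c
    swap : Atom → Atom → Carrier → Carrier
    swap-id : ∀ a x → swap a a x ≡ x
    swap-invol : ∀ a b x → swap a b (swap a b x) ≡ x
    swap-conj : ∀ a b c d x →
      swap a b (swap c d x) ≡ swap (sw a b c) (sw a b d) (swap a b x)
    supp : Carrier → List Atom
    supp-supports : ∀ x → Supports swap (supp x) x
    supp-least : ∀ x (A : List Atom) → Supports swap A x → ∀ a → a ∈ supp x → a ∈ A

  _#_ : Atom → Carrier → Set
  a # x = a ∉ supp x

  _#ˢ_ : List Atom → Carrier → Set
  A #ˢ x = ∀ a → a ∈ A → a # x

record NominalPoset (c ℓ : Level) : Set (suc (c ⊔ ℓ)) where
  field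
    nominalSet : NominalSet c
  open NominalSet nominalSet public
  field
    _≤_ : Carrier → Carrier → Set ℓ
    isPartialOrder : IsPartialOrder _≡_ _≤_
    ≤-equivariant : ∀ a b {x y} → x ≤ y → swap a b x ≤ swap a b y

module _ {c ℓ : Level} (L : NominalPoset c ℓ) where
  open NominalPoset L

  FreshLowerBound : List Atom → List Carrier → Carrier → Set (c ⊔ ℓ)
  FreshLowerBound A X x' = (A #ˢ x') × (∀ x → x ∈ X → x' ≤ x)

  FreshUpperBound : List Atom → List Carrier → Carrier → Set (c ⊔ ℓ)
  FreshUpperBound A X x' = (A #ˢ x') × (∀ x → x ∈ X → x ≤ x')

  IsFreshLimit : List Atom → List Carrier → Carrier → Set (c ⊔ ℓ)
  IsFreshLimit A X y = FreshLowerBound A X y × (∀ x' → FreshLowerBound A X x' → x' ≤ y)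

  IsFreshColimit : List Atom → List Carrier → Carrier → Set (c ⊔ ℓ)
  IsFreshColimit A X y = FreshUpperBound A X y × (∀ x' → FreshUpperBound A X x' → y ≤ x')

  FinitelyFreshComplete : Set (c ⊔ ℓ)
  FinitelyFreshComplete = ∀ (X : List Carrier) (A : List Atom) → Σ Carrier (IsFreshLimit A X)

  FinitelyFreshCocomplete : Set (c ⊔ ℓ)
  FinitelyFreshCocomplete = ∀ (X : List Carrier) (A : List Atom) → Σ Carrier (IsFreshColimit A X)

  HasGreatest : Set (c ⊔ ℓ)
  HasGreatest = Σ Carrier λ t → ∀ x → x ≤ t

  HasLeast : Set (c ⊔ ℓ)
  HasLeast = Σ Carrier λ b → ∀ x → b ≤ x

  IsGLB : Carrier → Carrier → Carrier → Set (c ⊔ ℓ)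
  IsGLB x y m = (m ≤ x × m ≤ y) × (∀ z → z ≤ x → z ≤ y → z ≤ m)

  IsLUB : Carrier → Carrier → Carrier → Set (c ⊔ ℓ)
  IsLUB x y j = (x ≤ j × y ≤ j) × (∀ z → x ≤ z → y ≤ z → j ≤ z)

  HasBinaryMeets : Set (c ⊔ ℓ)
  HasBinaryMeets = ∀ x y → Σ Carrier (IsGLB x y)

  HasBinaryJoins : Set (c ⊔ ℓ)
  HasBinaryJoins = ∀ x y → Σ Carrier (IsLUB x y)

  HasSingletonFreshLimits : Set (c ⊔ ℓ)
  HasSingletonFreshLimits = ∀ (a : Atom) (x : Carrier) → Σ Carrier (IsFreshLimit (a ∷ []) (x ∷ []))

  HasSingletonFreshColimits : Set (c ⊔ ℓ)
  HasSingletonFreshColimits = ∀ (a : Atom) (x : Carrier) → Σ Carrier (IsFreshColimit (a ∷ []) (x ∷ []))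

-- An A#limit of X is obtained in two stages: first the meet m of X (built from ⊤ and binary
-- meets), then the singleton fresh limits ⋀^{#a₁} ⋯ ⋀^{#aₙ} m, one atom at a time.  This works
-- because an a#limit y of x is fixed by every transposition of atoms outside {a} ∪ supp x
-- (both y and its transpose are a#limits of x), so supp y ⊆ {a} ∪ supp x: forming the a#limit
-- never destroys freshness already achieved for earlier atoms.  Colimits are limits in the
-- opposite order.
module Submission where

open import Defs
open import Level using (Level)
open import Data.Product using (_×_; _,_; proj₁; proj₂)
open import Data.Nat using (_≟_)
open import Data.List using (List; []; _∷_; map)
open import Data.List.Membership.Propositional using (_∈_; _∉_)
open import Data.List.Membership.Propositional.Properties using (∈-map⁺; ∈-map⁻)
open import Data.List.Relation.Unary.Any using (here; there)
open import Relation.Nullary using (¬_; Dec; yes; no)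
open import Relation.Nullary.Negation using (contradiction)
open import Relation.Binary.PropositionalEquality
  using (_≡_; refl; sym; trans; cong; cong₂; subst; module ≡-Reasoning)
open import Relation.Binary.Structures using (IsPartialOrder)
import Relation.Binary.Construct.Flip.EqAndOrd as Flip
open import Function using (flip)
open import Function.Bundles using (_⇔_; mk⇔)

sw-left : ∀ a b → sw a b a ≡ b
sw-left a b with a ≟ a
... | yes _ = refl
... | no a≢a = contradiction refl a≢a

sw-right : ∀ a b → sw a b b ≡ a
sw-right a b with b ≟ a
... | yes b≡a = b≡a
... | no _ with b ≟ b
...   | yes _ = refl
...   | no b≢b = contradiction refl b≢b

sw-other : ∀ a b c → ¬ c ≡ a → ¬ c ≡ b → sw a b c ≡ c
sw-other a b c c≢a c≢b with c ≟ a
... | yes c≡a = contradiction c≡a c≢a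
... | no _ with c ≟ b
...   | yes c≡b = contradiction c≡b c≢b
...   | no _ = refl

sw-involutive : ∀ a b c → sw a b (sw a b c) ≡ c
sw-involutive a b c = cases (c ≟ a) (c ≟ b)
  where
  cases : Dec (c ≡ a) → Dec (c ≡ b) → sw a b (sw a b c) ≡ c
  cases (yes refl) _ = trans (cong (sw c b) (sw-left c b)) (sw-right c b)
  cases (no _) (yes refl) = trans (cong (sw a c) (sw-right a c)) (sw-left a c)
  cases (no c≢a) (no c≢b) =
    trans (cong (sw a b) (sw-other a b c c≢a c≢b)) (sw-other a b c c≢a c≢b)

module _ {c : Level} (N : NominalSet c) where
  open NominalSet N

  swap-supports : ∀ d e {A x} → Supports swap A x → Supports swap (map (sw d e) A) (swap d e x)
  swap-supports d e {A} {x} A-supports f g f∉ g∉ = begin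
    swap f g (swap d e x)
      ≡⟨ cong₂ (λ u v → swap u v (swap d e x)) (sym (sw-involutive d e f)) (sym (sw-involutive d e g)) ⟩
    swap (sw d e (sw d e f)) (sw d e (sw d e g)) (swap d e x)
      ≡⟨ sym (swap-conj d e (sw d e f) (sw d e g) x) ⟩
    swap d e (swap (sw d e f) (sw d e g) x)
      ≡⟨ cong (swap d e) (A-supports (sw d e f) (sw d e g) (sw-∉ f∉) (sw-∉ g∉)) ⟩
    swap d e x ∎
    where
    open ≡-Reasoning
    sw-∉ : ∀ {h} → h ∉ map (sw d e) A → sw d e h ∉ A
    sw-∉ {h} h∉ h'∈ = h∉ (subst (_∈ map (sw d e) A) (sw-involutive d e h) (∈-map⁺ (sw d e) h'∈))

  supp-swap : ∀ d e x {a} → a ∈ supp (swap d e x) → sw d e a ∈ supp x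
  supp-swap d e x {a} a∈
    with ∈-map⁻ (sw d e) (supp-least (swap d e x) _ (swap-supports d e (supp-supports x)) a a∈)
  ... | z , z∈ , refl = subst (_∈ supp x) (sym (sw-involutive d e z)) z∈

  #-swap : ∀ d e x {a} → sw d e a # x → a # swap d e x
  #-swap d e x a' a∈ = a' (supp-swap d e x a∈)

module _ {c ℓ : Level} (L : NominalPoset c ℓ) where
  open NominalPoset L
  module PO = IsPartialOrder isPartialOrder

  singletonFreshLowerBound : ∀ {a x z} → a # z → z ≤ x → FreshLowerBound L (a ∷ []) (x ∷ []) z
  singletonFreshLowerBound a#z z≤x =
    (λ { _ (here refl) → a#z }) , λ { _ (here refl) → z≤x }

  freshLimit-supported : ∀ {a x y} → IsFreshLimit L (a ∷ []) (x ∷ []) y → Supports swap (a ∷ supp x) y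
  freshLimit-supported {a} {x} {y} ((fresh , lower) , greatest) d e d∉ e∉ =
    PO.antisym y'≤y (subst (_≤ swap d e y) (swap-invol d e y) (≤-equivariant d e y'≤y))
    where
    x-fixed : swap d e x ≡ x
    x-fixed = supp-supports x d e (λ d∈ → d∉ (there d∈)) (λ e∈ → e∉ (there e∈))
    a-fixed : sw d e a ≡ a
    a-fixed = sw-other d e a (λ a≡d → d∉ (here (sym a≡d))) (λ a≡e → e∉ (here (sym a≡e)))
    y'≤y : swap d e y ≤ y
    y'≤y = greatest (swap d e y) (singletonFreshLowerBound
      (#-swap nominalSet d e y (subst (_# y) (sym a-fixed) (fresh a (here refl))))
      (subst (swap d e y ≤_) x-fixed (≤-equivariant d e (lower x (here refl)))))

  freshLimit-preserves-# : ∀ {a x y b} → IsFreshLimit L (a ∷ []) (x ∷ []) y → b # x → b # y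
  freshLimit-preserves-# {a} {x} {y} {b} limit b#x with b ≟ a
  ... | yes refl = proj₁ (proj₁ limit) b (here refl)
  ... | no b≢a = λ b∈ → outside (supp-least y (a ∷ supp x) (freshLimit-supported limit) b b∈)
    where
    outside : b ∉ a ∷ supp x
    outside (here b≡a) = b≢a b≡a
    outside (there b∈x) = b#x b∈x

  complete⇒meets : FinitelyFreshComplete L → HasGreatest L × HasBinaryMeets L × HasSingletonFreshLimits L
  complete⇒meets complete = top , meet , λ a x → complete (x ∷ []) (a ∷ [])
    where
    top : HasGreatest L
    top with complete [] []
    ... | t , _ , greatest = t , λ x → greatest x ((λ _ ()) , λ _ ())
    meet : HasBinaryMeets L
    meet x y with complete (x ∷ y ∷ []) []
    ... | m , (_ , lower) , greatest =
      m , (lower x (here refl) , lower y (there (here refl)))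
        , λ z z≤x z≤y → greatest z ((λ _ ()) , λ { _ (here refl) → z≤x ; _ (there (here refl)) → z≤y })

  module FromMeets (top : HasGreatest L) (meet : HasBinaryMeets L) (limit : HasSingletonFreshLimits L) where

    ⋀ : List Carrier → Carrier
    ⋀ [] = proj₁ top
    ⋀ (x ∷ xs) = proj₁ (meet x (⋀ xs))

    ⋀-lower : ∀ X {x} → x ∈ X → ⋀ X ≤ x
    ⋀-lower (y ∷ X) (here refl) = proj₁ (proj₁ (proj₂ (meet y (⋀ X))))
    ⋀-lower (y ∷ X) (there x∈X) = PO.trans (proj₂ (proj₁ (proj₂ (meet y (⋀ X))))) (⋀-lower X x∈X)

    ⋀-greatest : ∀ X {z} → (∀ x → x ∈ X → z ≤ x) → z ≤ ⋀ X
    ⋀-greatest [] {z} _ = proj₂ top z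
    ⋀-greatest (y ∷ X) {z} lower =
      proj₂ (proj₂ (meet y (⋀ X))) z (lower y (here refl)) (⋀-greatest X λ x x∈ → lower x (there x∈))

    freshen : List Atom → Carrier → Carrier
    freshen [] m = m
    freshen (a ∷ A) m = proj₁ (limit a (freshen A m))

    freshen-limit : ∀ a A m → IsFreshLimit L (a ∷ []) (freshen A m ∷ []) (freshen (a ∷ A) m)
    freshen-limit a A m = proj₂ (limit a (freshen A m))

    freshen-≤ : ∀ A m → freshen A m ≤ m
    freshen-≤ [] m = PO.refl
    freshen-≤ (a ∷ A) m = PO.trans (proj₂ (proj₁ (freshen-limit a A m)) _ (here refl)) (freshen-≤ A m)

    freshen-fresh : ∀ A m → A #ˢ freshen A m
    freshen-fresh (a ∷ A) m b (here refl) = proj₁ (proj₁ (freshen-limit a A m)) b (here refl)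
    freshen-fresh (a ∷ A) m b (there b∈A) =
      freshLimit-preserves-# (freshen-limit a A m) (freshen-fresh A m b b∈A)

    freshen-greatest : ∀ A m {z} → z ≤ m → A #ˢ z → z ≤ freshen A m
    freshen-greatest [] m z≤m _ = z≤m
    freshen-greatest (a ∷ A) m {z} z≤m A#z = proj₂ (freshen-limit a A m) z
      (singletonFreshLowerBound (A#z a (here refl))
        (freshen-greatest A m z≤m λ b b∈A → A#z b (there b∈A)))

    complete : FinitelyFreshComplete L
    complete X A = freshen A (⋀ X)
      , (freshen-fresh A (⋀ X) , λ x x∈X → PO.trans (freshen-≤ A (⋀ X)) (⋀-lower X x∈X))
      , λ z (A#z , lower) → freshen-greatest A (⋀ X) (⋀-greatest X lower) A#z

  complete⇔meets : FinitelyFreshComplete L ⇔ (HasGreatest L × HasBinaryMeets L × HasSingletonFreshLimits L)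
  complete⇔meets = mk⇔ complete⇒meets λ (top , meet , limit) → FromMeets.complete top meet limit

opposite : ∀ {c ℓ} → NominalPoset c ℓ → NominalPoset c ℓ
opposite L = record
  { nominalSet = nominalSet
  ; _≤_ = flip _≤_
  ; isPartialOrder = Flip.isPartialOrder isPartialOrder
  ; ≤-equivariant = λ a b → ≤-equivariant a b
  }
  where open NominalPoset L

proposition4p5 : ∀ {c ℓ : Level} (L : NominalPoset c ℓ) →
    (FinitelyFreshComplete L ⇔ (HasGreatest L × HasBinaryMeets L × HasSingletonFreshLimits L))
    × (FinitelyFreshCocomplete L ⇔ (HasLeast L × HasBinaryJoins L × HasSingletonFreshColimits L))
proposition4p5 L = complete⇔meets L , complete⇔meets (opposite L)
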